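{- For $n \ge 2$, let $R_n$ be the $2\times n$ rectangle. Then $$\min\{\mathsf{perim}(D) : D\in\mathcal{D}(R_n)\} = 2 \quad\text{and}\quad \max\{\mathsf{perim}(D) : D \in \mathcal{D}(R_n)\} = n.$$
   Context: A domino is a $1\times 2$ rectangle; $\mathcal{D}(R)$ is the set of tilings of a region $R$ by dominoes (placed on the unit grid). In a domino tiling of $R$, a domino is a (strong) perimeter domino if one of its sides of length $2$ lies in the boundary of $R$. $\mathsf{perim}(D)$ is the number of perimeter dominoes in the tiling $D$. -}

module Defs where

open import Data.Bool using (Bool; true; false; _∧_; not; T)
open import Data.Integer using (ℤ; +_; _+_; _-_; _≤?_; _<?_; 1ℤ)
open import Data.Nat using (ℕ)
open import Data.Product using (_×_; _,_; Σ)
open import Data.List using (List; length; lookup; filter)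
open import Data.List.Membership.Propositional using (_∈_)
open import Data.Fin using (Fin)
open import Relation.Nullary.Decidable using (⌊_⌋)
open import Relation.Binary.PropositionalEquality using (_≡_)

-- Unit cells of the plane grid, indexed by their lower-left corner (x , y):
-- the cell [x, x+1] × [y, y+1].
Cell : Set
Cell = ℤ × ℤ

Region : Set
Region = Cell → Bool

-- A domino placed on the grid:
--   horiz x y  covers cells (x , y) and (x+1 , y)
--   vert  x y  covers cells (x , y) and (x , y+1)
data Domino : Set where
  horiz : ℤ → ℤ → Domino
  vert  : ℤ → ℤ → Domino

covers : Domino → Cell → Set
covers (horiz x y) c = (c ≡ (x , y)) Data.Sum.⊎ (c ≡ (x + 1ℤ , y))
  where import Data.Sum
covers (vert x y)  c = (c ≡ (x , y)) Data.Sum.⊎ (c ≡ (x , y + 1ℤ))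
  where import Data.Sum

IsTiling : Region → List Domino → Set
IsTiling R ds =
  (∀ d → d ∈ ds → ∀ c → covers d c → T (R c)) ×
  (∀ c → T (R c) →
     Σ (Fin (length ds)) λ i →
       covers (lookup ds i) c × (∀ j → covers (lookup ds j) c → j ≡ i))

Tiling : Region → Set
Tiling R = Σ (List Domino) (IsTiling R)

-- A side of length 2 of a domino lies in the boundary of R iff both unit
-- cells on the other side of that side are outside R.
outside2 : Region → Cell → Cell → Bool
outside2 R c₁ c₂ = not (R c₁) ∧ not (R c₂)

-- (strong) perimeter domino: one of its two length-2 sides lies in ∂R
isPerimeter : Region → Domino → Bool
isPerimeter R (horiz x y) =
  Data.Bool._∨_ (outside2 R (x , y - 1ℤ) (x + 1ℤ , y - 1ℤ))
                (outside2 R (x , y + 1ℤ) (x + 1ℤ , y + 1ℤ))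
  where import Data.Bool
isPerimeter R (vert x y) =
  Data.Bool._∨_ (outside2 R (x - 1ℤ , y) (x - 1ℤ , y + 1ℤ))
                (outside2 R (x + 1ℤ , y) (x + 1ℤ , y + 1ℤ))
  where import Data.Bool

perim : (R : Region) → Tiling R → ℕ
perim R (ds , _) = length (filter (λ d → T? (isPerimeter R d)) ds)
  where
  open import Data.Bool.Properties using (T?)

rect2 : ℕ → Region
rect2 n (x , y) = ⌊ + 0 ≤? x ⌋ ∧ ⌊ x <? + n ⌋ ∧ ⌊ + 0 ≤? y ⌋ ∧ ⌊ y <? + 2 ⌋

-- Every domino of R_n covers one of the n "diagonal" cells (m , m mod 2), and
-- distinct dominoes of a tiling cover distinct cells, so a tiling has at most n
-- dominoes and hence at most n perimeter dominoes.  The dominoes covering the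
-- opposite corners (0 , 0) and (n - 1 , 1) are distinct and lie on the perimeter,
-- so there are at least two.  Both bounds are attained: in the tiling by n vertical
-- dominoes only the two end dominoes lie on the perimeter, while in the tiling by
-- stacked pairs of horizontal dominoes (closed by one vertical domino when n is odd)
-- every domino does.
module Submission where

open import Data.Bool using (true; false; T; not)
open import Data.Bool.Properties using (T?; T-∧; T-∨)
open import Data.Empty using (⊥; ⊥-elim)
open import Data.Fin as Fin using (Fin)
open import Data.Fin.Properties using (fromℕ<-injective; injective⇒≤)
open import Data.Integer as ℤ using (ℤ; +_; -[1+_]; 1ℤ)
import Data.Integer.Properties as ℤ
open import Data.List using (List; []; _∷_; length; lookup; filter; replicate)
open import Data.List.Membership.Propositional using (_∈_)
open import Data.List.Membership.Propositional.Properties using (∈-lookup)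
open import Data.List.Properties using (length-filter; filter-all; filter-accept; filter-reject; filter-some)
open import Data.List.Relation.Unary.All as All using (All; []; _∷_)
open import Data.List.Relation.Unary.AllPairs using (AllPairs; []; _∷_)
open import Data.List.Relation.Unary.Any as Any using (Any; here; there)
open import Data.List.Relation.Unary.Any.Properties using (lookup-index)
open import Data.Nat as ℕ using (ℕ; zero; suc; _≤_; _<_; z≤n; s≤s; z<s; parity)
open import Data.Nat.Properties
open import Data.Parity.Base using (Parity; 0ℙ; 1ℙ)
open import Data.Product using (Σ; ∃; _×_; _,_; proj₁; proj₂)
open import Data.Sum using (_⊎_; inj₁; inj₂)
open import Function.Bundles using (Equivalence)
open import Function.Base using (_∘_)
open import Relation.Nullary using (¬_; does; contradiction)
open import Relation.Nullary.Decidable using (toWitness; fromWitness)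
open import Relation.Unary using (Pred; Decidable)
open import Relation.Binary.PropositionalEquality

open import Defs

open Equivalence using (to; from)

¬T⇒T-not : ∀ {b} → ¬ T b → T (not b)
¬T⇒T-not {false} _ = _
¬T⇒T-not {true} ¬t = ¬t _

T-not⇒¬T : ∀ {b} → T (not b) → ¬ T b
T-not⇒¬T {false} _ ()

outside2⁺ : ∀ R {c₁ c₂} → ¬ T (R c₁) → ¬ T (R c₂) → T (outside2 R c₁ c₂)
outside2⁺ R ∉₁ ∉₂ = from T-∧ (¬T⇒T-not ∉₁ , ¬T⇒T-not ∉₂)

module _ (R : Region) (x y : ℤ) where

  perimeter-below : ¬ T (R (x , y ℤ.- 1ℤ)) → ¬ T (R (x ℤ.+ 1ℤ , y ℤ.- 1ℤ)) →
                    T (isPerimeter R (horiz x y))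
  perimeter-below ∉₁ ∉₂ = from T-∨ (inj₁ (outside2⁺ R ∉₁ ∉₂))

  perimeter-above : ¬ T (R (x , y ℤ.+ 1ℤ)) → ¬ T (R (x ℤ.+ 1ℤ , y ℤ.+ 1ℤ)) →
                    T (isPerimeter R (horiz x y))
  perimeter-above ∉₁ ∉₂ = from T-∨ (inj₂ (outside2⁺ R ∉₁ ∉₂))

  perimeter-left : ¬ T (R (x ℤ.- 1ℤ , y)) → ¬ T (R (x ℤ.- 1ℤ , y ℤ.+ 1ℤ)) →
                   T (isPerimeter R (vert x y))
  perimeter-left ∉₁ ∉₂ = from T-∨ (inj₁ (outside2⁺ R ∉₁ ∉₂))

  perimeter-right : ¬ T (R (x ℤ.+ 1ℤ , y)) → ¬ T (R (x ℤ.+ 1ℤ , y ℤ.+ 1ℤ)) →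
                    T (isPerimeter R (vert x y))
  perimeter-right ∉₁ ∉₂ = from T-∨ (inj₂ (outside2⁺ R ∉₁ ∉₂))

  not-perimeter-vert : T (R (x ℤ.- 1ℤ , y)) → T (R (x ℤ.+ 1ℤ , y)) →
                       ¬ T (isPerimeter R (vert x y))
  not-perimeter-vert ∈₁ ∈₂ t with to T-∨ t
  ... | inj₁ left  = T-not⇒¬T (proj₁ (to T-∧ left)) ∈₁
  ... | inj₂ right = T-not⇒¬T (proj₁ (to T-∧ right)) ∈₂

row : Parity → ℤ
row 0ℙ = + 0
row 1ℙ = + 1

covers-horiz⁻ : ∀ {m y c} → covers (horiz (+ m) y) c → c ≡ (+ m , y) ⊎ c ≡ (+ suc m , y)
covers-horiz⁻ (inj₁ refl) = inj₁ refl
covers-horiz⁻ {m} {y} (inj₂ refl) = inj₂ (cong (_, y) (ℤ.+-comm (+ m) 1ℤ))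

covers-horiz⁺ : ∀ {k m y} → m ≡ k ⊎ m ≡ suc k → covers (horiz (+ k) y) (+ m , y)
covers-horiz⁺ (inj₁ refl) = inj₁ refl
covers-horiz⁺ {k} {y = y} (inj₂ refl) = inj₂ (cong (_, y) (sym (ℤ.+-comm (+ k) 1ℤ)))

covers-vert-row : ∀ {m} p → covers (vert (+ m) (+ 0)) (+ m , row p)
covers-vert-row 0ℙ = inj₁ refl
covers-vert-row 1ℙ = inj₂ refl

module _ {n : ℕ} where

  rect2⁺ : ∀ {m} p → m < n → T (rect2 n (+ m , row p))
  rect2⁺ {m} p m<n =
    from T-∧ (fromWitness {a? = + 0 ℤ.≤? + m} (ℤ.+≤+ z≤n) ,
    from T-∧ (fromWitness {a? = + m ℤ.<? + n} (ℤ.+<+ m<n) ,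
    from T-∧ (fromWitness {a? = + 0 ℤ.≤? row p} (0≤row p) ,
              fromWitness {a? = row p ℤ.<? + 2} (row<2 p))))
    where
    0≤row : ∀ p → + 0 ℤ.≤ row p
    0≤row 0ℙ = ℤ.+≤+ z≤n
    0≤row 1ℙ = ℤ.+≤+ z≤n
    row<2 : ∀ p → row p ℤ.< + 2
    row<2 0ℙ = ℤ.+<+ (s≤s z≤n)
    row<2 1ℙ = ℤ.+<+ (s≤s (s≤s z≤n))

  rect2⁻ : ∀ {c} → T (rect2 n c) → ∃ λ m → ∃ λ p → c ≡ (+ m , row p) × m < n
  rect2⁻ {x , y} t with to T-∧ t
  ... | 0≤x , t′ with to T-∧ t′
  ... | x<n , t″ with to T-∧ t″
  ... | 0≤y , y<2
    with toWitness {a? = + 0 ℤ.≤? x} 0≤x | toWitness {a? = x ℤ.<? + n} x<n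
       | toWitness {a? = + 0 ℤ.≤? y} 0≤y | toWitness {a? = y ℤ.<? + 2} y<2
  ... | ℤ.+≤+ {n = m} _ | ℤ.+<+ m<n | ℤ.+≤+ _ | ℤ.+<+ (s≤s z≤n) = m , 0ℙ , refl , m<n
  ... | ℤ.+≤+ {n = m} _ | ℤ.+<+ m<n | ℤ.+≤+ _ | ℤ.+<+ (s≤s (s≤s z≤n)) = m , 1ℙ , refl , m<n

  below-rect2 : ∀ x → ¬ T (rect2 n (x , -[1+ 0 ]))
  below-rect2 x t with rect2⁻ {x , -[1+ 0 ]} t
  ... | _ , 0ℙ , () , _
  ... | _ , 1ℙ , () , _

  above-rect2 : ∀ x → ¬ T (rect2 n (x , + 2))
  above-rect2 x t with rect2⁻ {x , + 2} t
  ... | _ , 0ℙ , () , _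
  ... | _ , 1ℙ , () , _

  left-of-rect2 : ∀ y → ¬ T (rect2 n (-[1+ 0 ] , y))
  left-of-rect2 y t with rect2⁻ { -[1+ 0 ] , y} t
  ... | _ , _ , () , _

  right-of-rect2 : ∀ {m} y → n ≤ suc m → ¬ T (rect2 n (+ m ℤ.+ 1ℤ , y))
  right-of-rect2 {m} y n≤1+m t
    with rect2⁻ {+ suc m , y} (subst (λ x → T (rect2 n (x , y))) (ℤ.+-comm (+ m) 1ℤ) t)
  ... | _ , _ , refl , 1+m<n = <⇒≱ 1+m<n n≤1+m

  horizontal-perimeter : ∀ m p → T (isPerimeter (rect2 n) (horiz (+ m) (row p)))
  horizontal-perimeter m 0ℙ =
    perimeter-below (rect2 n) (+ m) (+ 0) (below-rect2 (+ m)) (below-rect2 (+ m ℤ.+ 1ℤ))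
  horizontal-perimeter m 1ℙ =
    perimeter-above (rect2 n) (+ m) (+ 1) (above-rect2 (+ m)) (above-rect2 (+ m ℤ.+ 1ℤ))

  left-column-perimeter : T (isPerimeter (rect2 n) (vert (+ 0) (+ 0)))
  left-column-perimeter =
    perimeter-left (rect2 n) (+ 0) (+ 0) (left-of-rect2 (+ 0)) (left-of-rect2 (+ 1))

  right-column-perimeter : ∀ {m} → suc m ≡ n → T (isPerimeter (rect2 n) (vert (+ m) (+ 0)))
  right-column-perimeter {m} refl =
    perimeter-right (rect2 n) (+ m) (+ 0) (right-of-rect2 (+ 0) ≤-refl) (right-of-rect2 (+ 1) ≤-refl)

  inner-column-not-perimeter : ∀ {m} → suc (suc m) < n →
                               ¬ T (isPerimeter (rect2 n) (vert (+ suc m) (+ 0)))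
  inner-column-not-perimeter {m} 2+m<n = not-perimeter-vert (rect2 n) (+ suc m) (+ 0)
    (rect2⁺ 0ℙ (<-trans (n<1+n m) (<-trans (n<1+n (suc m)) 2+m<n)))
    (subst (λ x → T (rect2 n (x , + 0))) (sym (ℤ.+-comm (+ suc m) 1ℤ)) (rect2⁺ 0ℙ 2+m<n))

data Rect2Domino (n : ℕ) : Domino → Set where
  horizontal : ∀ m p → suc m < n → Rect2Domino n (horiz (+ m) (row p))
  vertical   : ∀ m → m < n → Rect2Domino n (vert (+ m) (+ 0))

rect2-domino : ∀ {n} d → (∀ c → covers d c → T (rect2 n c)) → Rect2Domino n d
rect2-domino {n} (horiz x y) ⊆R with rect2⁻ {c = x , y} (⊆R _ (inj₁ refl))
... | m , p , refl , _ with rect2⁻ {c = + suc m , row p} (⊆R _ (covers-horiz⁺ (inj₂ refl)))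
...   | _ , _ , e , m′<n = horizontal m p (subst (_< n) (sym (ℤ.+-injective (cong proj₁ e))) m′<n)
rect2-domino {n} (vert x y) ⊆R
  with rect2⁻ {c = x , y} (⊆R _ (inj₁ refl))
     | rect2⁻ {c = x , y ℤ.+ 1ℤ} (⊆R _ (inj₂ refl))
... | m , 0ℙ , refl , m<n | _ = vertical m m<n
... | m , 1ℙ , refl , _ | _ , 0ℙ , () , _
... | m , 1ℙ , refl , _ | _ , 1ℙ , () , _

perimeter? : (R : Region) → Decidable (λ d → T (isPerimeter R d))
perimeter? R d = T? (isPerimeter R d)

perimeterCount : Region → List Domino → ℕ
perimeterCount R ds = length (filter (perimeter? R) ds)

tiling-length-≤ : ∀ {R n} (D : Tiling R) (cell : ℕ → Cell) →
                  (∀ {m} → m < n → T (R (cell m))) →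
                  (∀ d → d ∈ proj₁ D → ∃ λ m → m < n × covers d (cell m)) →
                  length (proj₁ D) ≤ n
tiling-length-≤ {R} {n} (ds , _ , cover) cell cell∈R hit = injective⇒≤ column-injective
  where
  column : Fin (length ds) → Fin n
  column i = Fin.fromℕ< (proj₁ (proj₂ (hit (lookup ds i) (∈-lookup i))))

  column-injective : ∀ {i j} → column i ≡ column j → i ≡ j
  column-injective {i} {j} eq
    with hit (lookup ds i) (∈-lookup i) | hit (lookup ds j) (∈-lookup j)
       | fromℕ<-injective _ _ _ _ eq
  ... | m , m<n , i-covers | _ , _ , j-covers | refl
    with cover (cell m) (cell∈R m<n)
  ... | _ , _ , unique = trans (unique i i-covers) (sym (unique j j-covers))

diagonal : ℕ → Cell
diagonal m = (+ m , row (parity m))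

parity-here-or-next : ∀ m p → parity m ≡ p ⊎ parity (suc m) ≡ p
parity-here-or-next zero          0ℙ = inj₁ refl
parity-here-or-next zero          1ℙ = inj₂ refl
parity-here-or-next (suc zero)    0ℙ = inj₂ refl
parity-here-or-next (suc zero)    1ℙ = inj₁ refl
parity-here-or-next (suc (suc m)) p  = parity-here-or-next m p

rect2-domino-covers-diagonal : ∀ {n d} → Rect2Domino n d → ∃ λ m → m < n × covers d (diagonal m)
rect2-domino-covers-diagonal (horizontal m p 1+m<n) with parity-here-or-next m p
... | inj₁ refl = m , <-trans (n<1+n m) 1+m<n , inj₁ refl
... | inj₂ refl = suc m , 1+m<n , inj₂ (cong (_, row (parity (suc m))) (sym (ℤ.+-comm (+ m) 1ℤ)))
rect2-domino-covers-diagonal (vertical m m<n) = m , m<n , covers-vert-row (parity m)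

perim-rect2-≤ : ∀ n (D : Tiling (rect2 n)) → perim (rect2 n) D ≤ n
perim-rect2-≤ n D@(ds , ⊆R , _) = begin
  perim (rect2 n) D  ≤⟨ length-filter (perimeter? (rect2 n)) ds ⟩
  length ds          ≤⟨ tiling-length-≤ D diagonal (λ {m} → rect2⁺ (parity m)) hits ⟩
  n                  ∎
  where
  open ≤-Reasoning
  hits : ∀ d → d ∈ ds → ∃ λ m → m < n × covers d (diagonal m)
  hits d d∈ds = rect2-domino-covers-diagonal (rect2-domino d (⊆R d d∈ds))

module _ {a p} {A : Set a} {P : Pred A p} (P? : Decidable P) where

  2≤length-filter : ∀ xs {i j} → i ≢ j → P (lookup xs i) → P (lookup xs j) →
                    2 ≤ length (filter P? xs)
  2≤length-filter (x ∷ xs) {Fin.zero} {Fin.zero} i≢j _ _ = contradiction refl i≢j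
  2≤length-filter (x ∷ xs) {Fin.zero} {Fin.suc j} _ px pj
    rewrite filter-accept P? {x = x} {xs = xs} px =
    s≤s (filter-some P? (Any.map (λ { refl → pj }) (∈-lookup {xs = xs} j)))
  2≤length-filter (x ∷ xs) {Fin.suc i} {Fin.zero} _ pi px
    rewrite filter-accept P? {x = x} {xs = xs} px =
    s≤s (filter-some P? (Any.map (λ { refl → pi }) (∈-lookup {xs = xs} i)))
  2≤length-filter (x ∷ xs) {Fin.suc i} {Fin.suc j} i≢j pi pj
    with ih ← 2≤length-filter xs (i≢j ∘ cong Fin.suc) pi pj | does (P? x)
  ... | true  = m≤n⇒m≤1+n ih
  ... | false = ih

covers-horiz-row : ∀ {x y c} → covers (horiz x y) c → proj₂ c ≡ y
covers-horiz-row (inj₁ refl) = refl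
covers-horiz-row (inj₂ refl) = refl

covers-vert-column : ∀ {x y c} → covers (vert x y) c → proj₁ c ≡ x
covers-vert-column (inj₁ refl) = refl
covers-vert-column (inj₂ refl) = refl

opposite-corners-apart : ∀ {k} d → covers d (+ 0 , + 0) → ¬ covers d (+ suc k , + 1)
opposite-corners-apart (horiz x y) c₁ c₂
  with trans (covers-horiz-row c₁) (sym (covers-horiz-row c₂))
... | ()
opposite-corners-apart (vert x y) c₁ c₂
  with trans (covers-vert-column c₁) (sym (covers-vert-column c₂))
... | ()

module _ {n : ℕ} where

  left-column-domino-perimeter : ∀ {d y} → Rect2Domino n d → covers d (+ 0 , y) →
                                 T (isPerimeter (rect2 n) d)
  left-column-domino-perimeter (horizontal m p _) _ = horizontal-perimeter {n} m p
  left-column-domino-perimeter (vertical m _) c with covers-vert-column c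
  ... | refl = left-column-perimeter {n}

  right-column-domino-perimeter : ∀ {d m y} → suc m ≡ n → Rect2Domino n d → covers d (+ m , y) →
                                  T (isPerimeter (rect2 n) d)
  right-column-domino-perimeter _ (horizontal m p _) _ = horizontal-perimeter {n} m p
  right-column-domino-perimeter 1+m≡n (vertical m _) c with covers-vert-column c
  ... | refl = right-column-perimeter {n} 1+m≡n

2≤perim-rect2 : ∀ k (D : Tiling (rect2 (suc (suc k)))) → 2 ≤ perim (rect2 (suc (suc k))) D
2≤perim-rect2 k (ds , ⊆R , cover)
  with cover (+ 0 , + 0) (rect2⁺ {suc (suc k)} 0ℙ z<s)
       | cover (+ suc k , + 1) (rect2⁺ {suc (suc k)} 1ℙ ≤-refl)
... | i , i-covers , _ | j , j-covers , _ =
  2≤length-filter (perimeter? (rect2 (suc (suc k)))) ds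
    (λ { refl → opposite-corners-apart _ i-covers j-covers })
    (left-column-domino-perimeter (shape i) i-covers)
    (right-column-domino-perimeter refl (shape j) j-covers)
  where
  shape : ∀ i → Rect2Domino (suc (suc k)) (lookup ds i)
  shape i = rect2-domino (lookup ds i) (⊆R _ (∈-lookup i))

Disjoint : Domino → Domino → Set
Disjoint d e = ∀ {c} → covers d c → covers e c → ⊥

disjoint-index-unique : ∀ {ds c} → AllPairs Disjoint ds → (i j : Fin (length ds)) →
                        covers (lookup ds i) c → covers (lookup ds j) c → i ≡ j
disjoint-index-unique (_ ∷ _) Fin.zero Fin.zero _ _ = refl
disjoint-index-unique (apart ∷ _) Fin.zero (Fin.suc j) c₁ c₂ =
  ⊥-elim (All.lookup apart (∈-lookup j) c₁ c₂)
disjoint-index-unique (apart ∷ _) (Fin.suc i) Fin.zero c₁ c₂ =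
  ⊥-elim (All.lookup apart (∈-lookup i) c₂ c₁)
disjoint-index-unique (_ ∷ apart) (Fin.suc i) (Fin.suc j) c₁ c₂ =
  cong Fin.suc (disjoint-index-unique apart i j c₁ c₂)

disjoint-cover-tiling : ∀ {R} ds → (∀ d → d ∈ ds → ∀ c → covers d c → T (R c)) →
                        AllPairs Disjoint ds → (∀ c → T (R c) → Any (λ d → covers d c) ds) →
                        IsTiling R ds
disjoint-cover-tiling {R} ds ⊆R apart cover = ⊆R , unique-cover
  where
  unique-cover : ∀ c → T (R c) → Σ (Fin (length ds)) λ i →
                   covers (lookup ds i) c × (∀ j → covers (lookup ds j) c → j ≡ i)
  unique-cover c c∈R = let d = cover c c∈R in
    Any.index d , lookup-index d ,
    λ j j-covers → disjoint-index-unique apart j (Any.index d) j-covers (lookup-index d)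

data Block : Set where
  column square : Block

width : List Block → ℕ
width []            = 0
width (column ∷ bs) = suc (width bs)
width (square ∷ bs) = suc (suc (width bs))

place : ℕ → List Block → List Domino
place k []            = []
place k (column ∷ bs) = vert (+ k) (+ 0) ∷ place (suc k) bs
place k (square ∷ bs) = horiz (+ k) (row 0ℙ) ∷ horiz (+ k) (row 1ℙ) ∷ place (suc (suc k)) bs

InColumns : ℕ → ℕ → Cell → Set
InColumns k l c = ∃ λ m → ∃ λ p → c ≡ (+ m , row p) × k ≤ m × m < l

inColumns-widen : ∀ {k k′ l l′ c} → k′ ≤ k → l ≤ l′ → InColumns k l c → InColumns k′ l′ c
inColumns-widen k′≤k l≤l′ (m , p , refl , k≤m , m<l) =
  m , p , refl , ≤-trans k′≤k k≤m , <-≤-trans m<l l≤l′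

inColumns-apart : ∀ {k l j c} → InColumns k l c → ¬ InColumns l j c
inColumns-apart {l = l} (m , _ , refl , _ , m<l) (_ , _ , e , l≤m′ , _) =
  <⇒≱ m<l (subst (l ≤_) (sym (ℤ.+-injective (cong proj₁ e))) l≤m′)

column-cells : ∀ {k c} → covers (vert (+ k) (+ 0)) c → InColumns k (suc k) c
column-cells (inj₁ refl) = _ , 0ℙ , refl , ≤-refl , ≤-refl
column-cells (inj₂ refl) = _ , 1ℙ , refl , ≤-refl , ≤-refl

square-cells : ∀ {k c} p → covers (horiz (+ k) (row p)) c → InColumns k (suc (suc k)) c
square-cells {k} p cov with covers-horiz⁻ cov
... | inj₁ refl = k , p , refl , ≤-refl , n≤1+n (suc k)
... | inj₂ refl = suc k , p , refl , n≤1+n k , ≤-refl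

+-suc-suc : ∀ k w → k ℕ.+ suc (suc w) ≡ suc (suc (k ℕ.+ w))
+-suc-suc k w = trans (+-suc k (suc w)) (cong suc (+-suc k w))

1+k≤k+1+w : ∀ k w → suc k ≤ k ℕ.+ suc w
1+k≤k+1+w k w = ≤-trans (s≤s (m≤m+n k w)) (≤-reflexive (sym (+-suc k w)))

2+k≤k+2+w : ∀ k w → suc (suc k) ≤ k ℕ.+ suc (suc w)
2+k≤k+2+w k w = ≤-trans (s≤s (s≤s (m≤m+n k w))) (≤-reflexive (sym (+-suc-suc k w)))

place-within : ∀ k bs {d c} → d ∈ place k bs → covers d c → InColumns k (k ℕ.+ width bs) c
place-within k (column ∷ bs) (here refl) cov =
  inColumns-widen ≤-refl (1+k≤k+1+w k (width bs)) (column-cells cov)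
place-within k (column ∷ bs) (there d∈) cov =
  inColumns-widen (n≤1+n k) (≤-reflexive (sym (+-suc k (width bs))))
    (place-within (suc k) bs d∈ cov)
place-within k (square ∷ bs) (here refl) cov =
  inColumns-widen ≤-refl (2+k≤k+2+w k (width bs)) (square-cells 0ℙ cov)
place-within k (square ∷ bs) (there (here refl)) cov =
  inColumns-widen ≤-refl (2+k≤k+2+w k (width bs)) (square-cells 1ℙ cov)
place-within k (square ∷ bs) (there (there d∈)) cov =
  inColumns-widen (≤-trans (n≤1+n k) (n≤1+n (suc k))) (≤-reflexive (sym (+-suc-suc k (width bs))))
    (place-within (suc (suc k)) bs d∈ cov)

rows-apart : ∀ {x x′} → Disjoint (horiz x (+ 0)) (horiz x′ (+ 1))
rows-apart c₀ c₁ with trans (sym (covers-horiz-row c₀)) (covers-horiz-row c₁)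
... | ()

place-apart : ∀ k bs → AllPairs Disjoint (place k bs)
place-apart k []            = []
place-apart k (column ∷ bs) =
  All.tabulate (λ e∈ c₁ c₂ → inColumns-apart (column-cells c₁) (place-within (suc k) bs e∈ c₂))
  ∷ place-apart (suc k) bs
place-apart k (square ∷ bs) =
  (rows-apart ∷ All.tabulate (λ e∈ c₁ c₂ → inColumns-apart (square-cells 0ℙ c₁) (rest e∈ c₂)))
  ∷ All.tabulate (λ e∈ c₁ c₂ → inColumns-apart (square-cells 1ℙ c₁) (rest e∈ c₂))
  ∷ place-apart (suc (suc k)) bs
  where
  rest : ∀ {d c} → d ∈ place (suc (suc k)) bs → covers d c →
         InColumns (suc (suc k)) (suc (suc k) ℕ.+ width bs) c
  rest = place-within (suc (suc k)) bs

square-covers : ∀ {k m} bs p → m ≡ k ⊎ m ≡ suc k →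
                Any (λ d → covers d (+ m , row p)) (place k (square ∷ bs))
square-covers _ 0ℙ m∈square = here (covers-horiz⁺ m∈square)
square-covers _ 1ℙ m∈square = there (here (covers-horiz⁺ m∈square))

place-covers : ∀ k bs {m} p → k ≤ m → m < k ℕ.+ width bs →
               Any (λ d → covers d (+ m , row p)) (place k bs)
place-covers k [] p k≤m m<k+0 = ⊥-elim (<⇒≱ m<k+0 (≤-trans (≤-reflexive (+-identityʳ k)) k≤m))
place-covers k (column ∷ bs) p k≤m m<k+w with m≤n⇒m<n∨m≡n k≤m
... | inj₂ refl = here (covers-vert-row p)
... | inj₁ k<m  = there (place-covers (suc k) bs p k<m
                     (<-≤-trans m<k+w (≤-reflexive (+-suc k (width bs)))))
place-covers k (square ∷ bs) {m} p k≤m m<k+w with m≤n⇒m<n∨m≡n k≤m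
... | inj₂ refl = square-covers bs p (inj₁ refl)
... | inj₁ k<m with m≤n⇒m<n∨m≡n k<m
...   | inj₂ refl = square-covers bs p (inj₂ refl)
...   | inj₁ 1+k<m = there (there (place-covers (suc (suc k)) bs p 1+k<m
                       (<-≤-trans m<k+w (≤-reflexive (+-suc-suc k (width bs))))))

place-tiling : ∀ {n} bs → width bs ≡ n → IsTiling (rect2 n) (place 0 bs)
place-tiling bs refl = disjoint-cover-tiling (place 0 bs) inside (place-apart 0 bs) covered
  where
  inside : ∀ d → d ∈ place 0 bs → ∀ c → covers d c → T (rect2 (width bs) c)
  inside d d∈ c cov with place-within 0 bs d∈ cov
  ... | _ , p , refl , _ , m<w = rect2⁺ p m<w
  covered : ∀ c → T (rect2 (width bs) c) → Any (λ d → covers d c) (place 0 bs)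
  covered c c∈R with rect2⁻ {c = c} c∈R
  ... | _ , p , refl , m<w = place-covers 0 bs p z≤n m<w

squares : ℕ → List Block
squares zero          = []
squares (suc zero)    = column ∷ []
squares (suc (suc m)) = square ∷ squares m

width-squares : ∀ m → width (squares m) ≡ m
width-squares zero          = refl
width-squares (suc zero)    = refl
width-squares (suc (suc m)) = cong (suc ∘ suc) (width-squares m)

length-place-squares : ∀ k m → length (place k (squares m)) ≡ m
length-place-squares k zero          = refl
length-place-squares k (suc zero)    = refl
length-place-squares k (suc (suc m)) = cong (suc ∘ suc) (length-place-squares (suc (suc k)) m)

place-squares-perimeter : ∀ {n} k m → k ℕ.+ m ≡ n →
                          All (λ d → T (isPerimeter (rect2 n) d)) (place k (squares m))
place-squares-perimeter     k zero          _ = []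
place-squares-perimeter     k (suc zero)    e = right-column-perimeter (trans (+-comm 1 k) e) ∷ []
place-squares-perimeter {n} k (suc (suc m)) e =
  horizontal-perimeter {n} k 0ℙ ∷ horizontal-perimeter {n} k 1ℙ ∷
  place-squares-perimeter (suc (suc k)) m (trans (sym (+-suc-suc k m)) e)

maximal-tiling : ∀ n → Σ (Tiling (rect2 n)) λ D → perim (rect2 n) D ≡ n
maximal-tiling n = (place 0 (squares n) , place-tiling (squares n) (width-squares n)) , (begin
  perimeterCount (rect2 n) (place 0 (squares n))
    ≡⟨ cong length (filter-all (perimeter? (rect2 n)) (place-squares-perimeter 0 n refl)) ⟩
  length (place 0 (squares n))
    ≡⟨ length-place-squares 0 n ⟩
  n ∎)
  where open ≡-Reasoning

columns : ℕ → List Block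
columns m = replicate m column

width-columns : ∀ m → width (columns m) ≡ m
width-columns zero    = refl
width-columns (suc m) = cong suc (width-columns m)

column-run-perimeterCount : ∀ {n} j k → suc k ℕ.+ suc j ≡ n →
                            perimeterCount (rect2 n) (place (suc k) (columns (suc j))) ≡ 1
column-run-perimeterCount {n} zero k e =
  cong length (filter-accept (perimeter? (rect2 n)) {x = vert (+ suc k) (+ 0)} {xs = []}
    (right-column-perimeter {n} (trans (+-comm 1 (suc k)) e)))
column-run-perimeterCount {n} (suc j) k e =
  trans (cong length (filter-reject (perimeter? (rect2 n)) {x = vert (+ suc k) (+ 0)}
                       {xs = place (suc (suc k)) (columns (suc j))}
                       (inner-column-not-perimeter {n} 2+k<n)))
        (column-run-perimeterCount j (suc k) e′)
  where
  e′ : suc (suc k) ℕ.+ suc j ≡ n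
  e′ = trans (sym (+-suc (suc k) (suc j))) e
  2+k<n : suc (suc k) < n
  2+k<n = subst (suc (suc k) <_) e′ (m<m+n (suc (suc k)) z<s)

minimal-tiling : ∀ k → Σ (Tiling (rect2 (suc (suc k)))) λ D → perim (rect2 (suc (suc k))) D ≡ 2
minimal-tiling k = (place 0 (columns n) , place-tiling (columns n) (width-columns n)) , (begin
  perimeterCount (rect2 n) (vert (+ 0) (+ 0) ∷ place 1 (columns (suc k)))
    ≡⟨ cong length (filter-accept (perimeter? (rect2 n)) {x = vert (+ 0) (+ 0)}
                                  {xs = place 1 (columns (suc k))} (left-column-perimeter {n})) ⟩
  suc (perimeterCount (rect2 n) (place 1 (columns (suc k))))
    ≡⟨ cong suc (column-run-perimeterCount k 0 refl) ⟩
  2 ∎)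
  where
  n = suc (suc k)
  open ≡-Reasoning

proposition5p4 : (n : ℕ) → 2 ≤ n →
    -- min { perim D : D ∈ 𝒟(R_n) } = 2
    ((Σ (Tiling (rect2 n)) λ D → perim (rect2 n) D ≡ 2) ×
     ((D : Tiling (rect2 n)) → 2 ≤ perim (rect2 n) D)) ×
    -- max { perim D : D ∈ 𝒟(R_n) } = n
    ((Σ (Tiling (rect2 n)) λ D → perim (rect2 n) D ≡ n) ×
     ((D : Tiling (rect2 n)) → perim (rect2 n) D ≤ n))
proposition5p4 (suc (suc k)) (s≤s (s≤s z≤n)) =
  (minimal-tiling k , 2≤perim-rect2 k) , (maximal-tiling (suc (suc k)) , perim-rect2-≤ (suc (suc k)))
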